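{- Let $(w_k)_{k\ge0}$ be a sequence of nonnegative weights with $w_0=1$, let $\Phi(t)=\sum_{k\ge0}w_kt^k$, and let $r\in\mathbb{Z}_{\ge1}$. Define the weight generating functions (as formal power series) \[ A_r(x,u)=\sum_{T} w(T)\,x^{|T|}u^{a_r(T)}, \qquad F_r(x)=\sum_{T\text{ of height}<r} w(T)\,x^{|T|}, \] where the sums run over all rooted plane (ordered) trees $T$ (in the second case only those of height less than $r$), $|T|$ is the number of vertices of $T$, and $w(T)=\prod_{j\ge0}w_j^{N_j(T)}$ with $N_j(T)$ the number of vertices of $T$ having exactly $j$ children. Then \[ A_r(x,u)=x\,\Phi(A_r(x,u))+\Big(1-\frac1u\Big)F_r(xu). \]
   Context: The "cutting leaves" reduction of a rooted tree removes all leaves (vertices without children) simultaneously; a tree consisting of a single vertex is removed entirely. For a rooted tree $T$, $a_r(T)$ denotes the total number of vertices removed when this reduction is applied $r$ times to $T$; equivalently, $a_r(T)$ is the number of vertices $v$ of $T$ whose fringe subtree (the subtree consisting of $v$ and all its descendants) has height less than $r$. The height of a rooted tree is the greatest distance from the root to a leaf.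
   Formalization: The weights $w_k$ take values in the nonnegative rationals. -}

module Defs where

open import Data.Nat as ℕ using (ℕ; zero; suc; _⊔_; _<?_; _≟_)
open import Data.List using (List; []; _∷_; length; map; concatMap; filter)
open import Data.Bool using (if_then_else_)
open import Relation.Nullary.Decidable using (⌊_⌋)
open import Data.Rational using (ℚ; 0ℚ; 1ℚ; _+_; _*_; _-_)

data Tree : Set where
  node : List Tree → Tree

mutual
  size : Tree → ℕ
  size (node ts) = suc (sizes ts)

  sizes : List Tree → ℕ
  sizes []       = 0
  sizes (t ∷ ts) = size t ℕ.+ sizes ts

mutual
  height : Tree → ℕ
  height (node [])       = 0
  height (node (t ∷ ts)) = suc (heights (t ∷ ts))

  heights : List Tree → ℕ
  heights []       = 0
  heights (t ∷ ts) = height t ⊔ heights ts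

-- a_r(T): number of vertices whose fringe subtree has height < r
mutual
  cutLeaves : ℕ → Tree → ℕ
  cutLeaves r (node ts) =
    (if ⌊ height (node ts) <? r ⌋ then 1 else 0) ℕ.+ cutLeavesL r ts

  cutLeavesL : ℕ → List Tree → ℕ
  cutLeavesL r []       = 0
  cutLeavesL r (t ∷ ts) = cutLeaves r t ℕ.+ cutLeavesL r ts

mutual
  weight : (ℕ → ℚ) → Tree → ℚ
  weight w (node ts) = w (length ts) * weightL w ts

  weightL : (ℕ → ℚ) → List Tree → ℚ
  weightL w []       = 1ℚ
  weightL w (t ∷ ts) = weight w t * weightL w ts

-- Enumeration of plane trees.
-- treesLe n     : all trees with at most n vertices (each exactly once)
-- forestsF l n  : all lists of length ≤ l of trees with ≤ n vertices each
mutual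
  treesLe : ℕ → List Tree
  treesLe zero    = []
  treesLe (suc n) = map node (forestsF n n)

  forestsF : ℕ → ℕ → List (List Tree)
  forestsF zero    n = [] ∷ []
  forestsF (suc l) n =
    [] ∷ concatMap (λ t → map (t ∷_) (forestsF l n)) (treesLe n)

treesOfSize : ℕ → List Tree
treesOfSize n = filter (λ t → size t ≟ n) (treesLe n)

sumL : List ℚ → ℚ
sumL []       = 0ℚ
sumL (q ∷ qs) = q + sumL qs

sumTo : ℕ → (ℕ → ℚ) → ℚ
sumTo zero    f = f 0
sumTo (suc n) f = sumTo n f + f (suc n)

-- Formal power series in x, u with rational coefficients:
-- S n m = coefficient of x^n u^m.

Series : Set
Series = ℕ → ℕ → ℚ

_⊕_ : Series → Series → Series
(S ⊕ T) n m = S n m + T n m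

_⊛_ : Series → Series → Series
(S ⊛ T) n m = sumTo n (λ i → sumTo m (λ j → S i j * T (n ℕ.∸ i) (m ℕ.∸ j)))

oneS : Series
oneS zero zero = 1ℚ
oneS _    _    = 0ℚ

_^S_ : Series → ℕ → Series
S ^S zero  = oneS
S ^S suc k = S ⊛ (S ^S k)

xTimes : Series → Series
xTimes S zero    m = 0ℚ
xTimes S (suc n) m = S n m

-- Φ(S) = Σ_k w_k S^k, for a series S with no x^0 terms (S 0 m = 0),
-- in which case only k ≤ n contribute to the coefficient of x^n.
applyΦ : (ℕ → ℚ) → Series → Series
applyΦ w S n m = sumTo n (λ k → w k * (S ^S k) n m)

-- (1 - 1/u) · S, for S with no x^n u^0 terms having nonzero coefficients
-- (so that no u^(-1) terms arise): coefficient of x^n u^m is S n m - S n (m+1)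
oneMinusInvU : Series → Series
oneMinusInvU S n m = S n m - S n (suc m)

A : (ℕ → ℚ) → ℕ → Series
A w r n m =
  sumL (map (weight w)
    (filter (λ t → cutLeaves r t ≟ m) (treesOfSize n)))

F : (ℕ → ℚ) → ℕ → ℕ → ℚ
F w r n =
  sumL (map (weight w)
    (filter (λ t → height t <? r) (treesOfSize n)))

-- F_r(xu) as a series in x, u: coefficient of x^n u^m is [n = m] F_r[n]
FatXU : (ℕ → ℚ) → ℕ → Series
FatXU w r n m = if ⌊ n ≟ m ⌋ then F w r n else 0ℚ

{-# OPTIONS --safe #-}
module Submission where

-- A tree is its root together with the tuple of its k subtrees: the root contributes x w_k, and
-- size, weight and a_r add up over the subtrees, except that a_r also counts the root when the
-- tree has height < r.  Without that extra count the trees with n + 1 vertices contribute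
-- Σ_k w_k [x^n] A_r^k, the coefficient of x Φ(A_r).  A tree T of height < r has all its vertices
-- counted, so the extra count moves its monomial from x^|T| u^(|T|-1) to x^|T| u^|T|; summed,
-- this is (1 - 1/u) F_r(xu).  To read sums over k-tuples of subtrees as coefficients of A_r^k,
-- every factor is enumerated by one list treesLe N: the sum over treesLe N of a function
-- vanishing on trees with more than p vertices does not depend on N ≥ p.

open import Defs
open import Data.Nat using (ℕ; _≤_)
open import Data.Rational using (ℚ; 0ℚ; 1ℚ) renaming (_≤_ to _≤ℚ_)
open import Relation.Binary.PropositionalEquality using (_≡_)

open import Data.Bool using (if_then_else_)
open import Data.List using (List; []; _∷_; length; map; concatMap; filter; _++_)
open import Data.List.Properties using (map-∘)
import Data.Nat as ℕ
open import Data.Nat using (zero; suc; _∸_; _<_; _≤′_; ≤′-refl; ≤′-step; _≟_; _<?_; z≤n; s≤s)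
open import Data.Nat.Properties
  using (≤-refl; ≤-trans; n≤1+n; suc-injective; <-≤-trans; ≤-<-trans; <-irrefl; m≤m+n; m≤n+m;
         m≤n+m∸n; m∸n≤m; +-monoʳ-<; m⊔n<o⇒m<o; m⊔n<o⇒n<o; ≤⇒≤′; ≤′⇒≤)
open import Data.Rational using (_+_; _*_; _-_; -_)
import Data.Rational.Properties as ℚₚ
open import Data.Rational.Solver using (module +-*-Solver)
open import Algebra.Bundles using (CommutativeMonoid)
open import Algebra.Properties.CommutativeSemigroup
  (CommutativeMonoid.commutativeSemigroup ℚₚ.+-0-commutativeMonoid) using (interchange)
open import Relation.Binary.PropositionalEquality
  using (refl; sym; trans; cong; cong₂; subst; module ≡-Reasoning)
open import Function.Base using (_∘_)
open import Function.Bundles using (_⇔_; mk⇔; module Equivalence)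
open import Relation.Nullary using (Dec; yes; no; ¬_; contradiction)
open import Relation.Nullary.Decidable using (⌊_⌋)
open import Relation.Unary using (Decidable)

open ≡-Reasoning

private
  variable
    P Q P′ Q′ : Set
    X Y : Set

infixr 7 [_]·_

[_]·_ : Dec P → ℚ → ℚ
[ d ]· x = if ⌊ d ⌋ then x else 0ℚ

[]·-no : (d : Dec P) → ¬ P → ∀ x → [ d ]· x ≡ 0ℚ
[]·-no (yes p) ¬p x = contradiction p ¬p
[]·-no (no _)  _  x = refl

[]·-⇔ : P ⇔ Q → (d : Dec P) (e : Dec Q) → ∀ x → [ d ]· x ≡ [ e ]· x
[]·-⇔ _   (yes _) (yes _) x = refl
[]·-⇔ _   (no _)  (no _)  x = refl
[]·-⇔ P⇔Q (yes p) (no ¬q) x = contradiction (Equivalence.to P⇔Q p) ¬q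
[]·-⇔ P⇔Q (no ¬p) (yes q) x = contradiction (Equivalence.from P⇔Q q) ¬p

[]·-suc≟suc : ∀ m n x → [ suc m ≟ suc n ]· x ≡ [ m ≟ n ]· x
[]·-suc≟suc m n = []·-⇔ (mk⇔ suc-injective (cong suc)) (suc m ≟ suc n) (m ≟ n)

[]·-zero : (d : Dec P) → [ d ]· 0ℚ ≡ 0ℚ
[]·-zero (yes _) = refl
[]·-zero (no _)  = refl

[]·-*ʳ : (d : Dec P) → ∀ x y → x * ([ d ]· y) ≡ [ d ]· (x * y)
[]·-*ʳ (yes _) x y = refl
[]·-*ʳ (no _)  x y = ℚₚ.*-zeroʳ x

[]·-*-[]· : (a : Dec P) (b : Dec Q) (c : Dec P′) (d : Dec Q′) → ∀ x y →
  ([ a ]· [ b ]· x) * ([ c ]· [ d ]· y) ≡ [ a ]· [ c ]· [ b ]· [ d ]· (x * y)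
[]·-*-[]· (no _)  b       c d x y = ℚₚ.*-zeroˡ ([ c ]· [ d ]· y)
[]·-*-[]· (yes _) (no _)  c d x y = trans (ℚₚ.*-zeroˡ ([ c ]· [ d ]· y)) (sym ([]·-zero c))
[]·-*-[]· (yes _) (yes _) c d x y = trans ([]·-*ʳ c x _) (cong ([ c ]·_) ([]·-*ʳ d x y))

∑ : List X → (X → ℚ) → ℚ
∑ L f = sumL (map f L)

infixr 5 ∑
syntax ∑ L (λ x → e) = ∑[ x ∈ L ] e

∑-cong : (L : List X) {f g : X → ℚ} → (∀ x → f x ≡ g x) → ∑ L f ≡ ∑ L g
∑-cong []      _   = refl
∑-cong (x ∷ L) f≡g = cong₂ _+_ (f≡g x) (∑-cong L f≡g)

∑-zero : (L : List X) {f : X → ℚ} → (∀ x → f x ≡ 0ℚ) → ∑ L f ≡ 0ℚ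
∑-zero []      _   = refl
∑-zero (x ∷ L) f≡0 = cong₂ _+_ (f≡0 x) (∑-zero L f≡0)

∑-++ : (L M : List X) (f : X → ℚ) → ∑ (L ++ M) f ≡ ∑ L f + ∑ M f
∑-++ []      M f = sym (ℚₚ.+-identityˡ _)
∑-++ (x ∷ L) M f = trans (cong (f x +_) (∑-++ L M f)) (sym (ℚₚ.+-assoc (f x) _ _))

∑-map : (h : X → Y) (L : List X) (f : Y → ℚ) → ∑ (map h L) f ≡ ∑[ x ∈ L ] f (h x)
∑-map h L f = cong sumL (sym (map-∘ L))

∑-concatMap : (h : X → List Y) (L : List X) (f : Y → ℚ) →
  ∑ (concatMap h L) f ≡ ∑[ x ∈ L ] ∑ (h x) f
∑-concatMap h []      f = refl
∑-concatMap h (x ∷ L) f = trans (∑-++ (h x) _ f) (cong (∑ (h x) f +_) (∑-concatMap h L f))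

∑-conses : (L : List X) (Ls : List (List X)) (f : List X → ℚ) →
  ∑ (concatMap (λ x → map (x ∷_) Ls) L) f ≡ ∑[ x ∈ L ] ∑[ xs ∈ Ls ] f (x ∷ xs)
∑-conses L Ls f = trans (∑-concatMap _ L f) (∑-cong L (λ x → ∑-map (x ∷_) Ls f))

∑-filter : {P : X → Set} (P? : Decidable P) (L : List X) (f : X → ℚ) →
  ∑ (filter P? L) f ≡ ∑[ x ∈ L ] [ P? x ]· f x
∑-filter P? []      f = refl
∑-filter P? (x ∷ L) f with P? x
... | yes _ = cong (f x +_) (∑-filter P? L f)
... | no _  = trans (∑-filter P? L f) (sym (ℚₚ.+-identityˡ _))

∑-distrib-+ : (L : List X) (f g : X → ℚ) → ∑[ x ∈ L ] (f x + g x) ≡ ∑ L f + ∑ L g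
∑-distrib-+ []      f g = refl
∑-distrib-+ (x ∷ L) f g =
  trans (cong (f x + g x +_) (∑-distrib-+ L f g)) (interchange (f x) (g x) (∑ L f) (∑ L g))

∑-distrib-- : (L : List X) (f g : X → ℚ) → ∑[ x ∈ L ] (f x - g x) ≡ ∑ L f - ∑ L g
∑-distrib-- []      f g = refl
∑-distrib-- (x ∷ L) f g = begin
    (f x - g x) + (∑[ y ∈ L ] (f y - g y))
  ≡⟨ cong (f x - g x +_) (∑-distrib-- L f g) ⟩
    (f x - g x) + (∑ L f - ∑ L g)
  ≡⟨ interchange (f x) (- g x) (∑ L f) (- ∑ L g) ⟩
    (f x + ∑ L f) + (- g x + - ∑ L g)
  ≡⟨ cong (f x + ∑ L f +_) (ℚₚ.neg-distrib-+ (g x) (∑ L g)) ⟨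
    (f x + ∑ L f) - (g x + ∑ L g)
  ∎

*-distribˡ-∑ : ∀ c (L : List X) (f : X → ℚ) → c * ∑ L f ≡ ∑[ x ∈ L ] (c * f x)
*-distribˡ-∑ c []      f = ℚₚ.*-zeroʳ c
*-distribˡ-∑ c (x ∷ L) f =
  trans (ℚₚ.*-distribˡ-+ c (f x) _) (cong (c * f x +_) (*-distribˡ-∑ c L f))

∑-*-∑ : (L : List X) (M : List Y) (f : X → ℚ) (g : Y → ℚ) →
  ∑ L f * ∑ M g ≡ ∑[ x ∈ L ] ∑[ y ∈ M ] (f x * g y)
∑-*-∑ []      M f g = ℚₚ.*-zeroˡ (∑ M g)
∑-*-∑ (x ∷ L) M f g =
  trans (ℚₚ.*-distribʳ-+ (∑ M g) (f x) (∑ L f)) (cong₂ _+_ (*-distribˡ-∑ (f x) M g) (∑-*-∑ L M f g))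

[]·-distrib-∑ : (d : Dec P) (L : List X) (f : X → ℚ) → [ d ]· ∑ L f ≡ ∑[ x ∈ L ] [ d ]· f x
[]·-distrib-∑ (yes _) L f = refl
[]·-distrib-∑ (no _)  L f = sym (∑-zero L (λ _ → refl))

sumTo-cong : ∀ n {f g : ℕ → ℚ} → (∀ i → i ≤ n → f i ≡ g i) → sumTo n f ≡ sumTo n g
sumTo-cong zero    f≡g = f≡g 0 z≤n
sumTo-cong (suc n) f≡g =
  cong₂ _+_ (sumTo-cong n (λ i i≤n → f≡g i (≤-trans i≤n (n≤1+n n)))) (f≡g (suc n) ≤-refl)

sumTo-zero : ∀ n → sumTo n (λ _ → 0ℚ) ≡ 0ℚ
sumTo-zero zero    = refl
sumTo-zero (suc n) = cong (_+ 0ℚ) (sumTo-zero n)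

sumTo-suc : ∀ n (f : ℕ → ℚ) → sumTo (suc n) f ≡ f 0 + sumTo n (λ i → f (suc i))
sumTo-suc zero    f = refl
sumTo-suc (suc n) f = trans (cong (_+ f (suc (suc n))) (sumTo-suc n f)) (ℚₚ.+-assoc (f 0) _ _)

sumTo-∑-comm : ∀ n (L : List X) (f : ℕ → X → ℚ) →
  sumTo n (λ i → ∑ L (f i)) ≡ ∑[ x ∈ L ] sumTo n (λ i → f i x)
sumTo-∑-comm zero    L f = refl
sumTo-∑-comm (suc n) L f =
  trans (cong (_+ ∑ L (f (suc n))) (sumTo-∑-comm n L f)) (sym (∑-distrib-+ L _ (f (suc n))))

[]·-distrib-sumTo : (d : Dec P) → ∀ n (f : ℕ → ℚ) →
  [ d ]· sumTo n f ≡ sumTo n (λ i → [ d ]· f i)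
[]·-distrib-sumTo (yes _) n f = refl
[]·-distrib-sumTo (no _)  n f = sym (sumTo-zero n)

sumTo-convolution : ∀ n a b y →
  sumTo n (λ i → [ a ≟ i ]· [ b ≟ n ∸ i ]· y) ≡ [ a ℕ.+ b ≟ n ]· y
sumTo-convolution zero    zero    b y = refl
sumTo-convolution zero    (suc a) b y = refl
sumTo-convolution (suc n) zero    b y = begin
    sumTo (suc n) (λ i → [ 0 ≟ i ]· [ b ≟ suc n ∸ i ]· y)
  ≡⟨ sumTo-suc n _ ⟩
    [ b ≟ suc n ]· y + sumTo n (λ _ → 0ℚ)
  ≡⟨ cong ([ b ≟ suc n ]· y +_) (sumTo-zero n) ⟩
    [ b ≟ suc n ]· y + 0ℚ
  ≡⟨ ℚₚ.+-identityʳ ([ b ≟ suc n ]· y) ⟩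
    [ b ≟ suc n ]· y
  ∎
sumTo-convolution (suc n) (suc a) b y = begin
    sumTo (suc n) (λ i → [ suc a ≟ i ]· [ b ≟ suc n ∸ i ]· y)
  ≡⟨ sumTo-suc n _ ⟩
    0ℚ + sumTo n (λ i → [ suc a ≟ suc i ]· [ b ≟ n ∸ i ]· y)
  ≡⟨ ℚₚ.+-identityˡ _ ⟩
    sumTo n (λ i → [ suc a ≟ suc i ]· [ b ≟ n ∸ i ]· y)
  ≡⟨ sumTo-cong n (λ i _ → []·-suc≟suc a i _) ⟩
    sumTo n (λ i → [ a ≟ i ]· [ b ≟ n ∸ i ]· y)
  ≡⟨ sumTo-convolution n a b y ⟩
    [ a ℕ.+ b ≟ n ]· y
  ≡⟨ []·-suc≟suc (a ℕ.+ b) n y ⟨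
    [ suc a ℕ.+ b ≟ suc n ]· y
  ∎

⊛-cong : ∀ {S S′ T T′ : Series} n m →
  (∀ i j → i ≤ n → S i j ≡ S′ i j) → (∀ i j → i ≤ n → T i j ≡ T′ i j) →
  (S ⊛ T) n m ≡ (S′ ⊛ T′) n m
⊛-cong n m S≡S′ T≡T′ = sumTo-cong n (λ i i≤n → sumTo-cong m (λ j _ →
  cong₂ _*_ (S≡S′ i j i≤n) (T≡T′ (n ∸ i) (m ∸ j) (m∸n≤m n i))))

genSeries : (X → ℕ) → (X → ℕ) → (X → ℚ) → List X → Series
genSeries s c v L n m = ∑[ x ∈ L ] [ s x ≟ n ]· [ c x ≟ m ]· v x

genSeries-⊛ : (s₁ c₁ : X → ℕ) (v₁ : X → ℚ) (L : List X)
              (s₂ c₂ : Y → ℕ) (v₂ : Y → ℚ) (M : List Y) → ∀ n m →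
  (genSeries s₁ c₁ v₁ L ⊛ genSeries s₂ c₂ v₂ M) n m ≡
  ∑[ x ∈ L ] ∑[ y ∈ M ] [ s₁ x ℕ.+ s₂ y ≟ n ]· [ c₁ x ℕ.+ c₂ y ≟ m ]· (v₁ x * v₂ y)
genSeries-⊛ {X = X} {Y = Y} s₁ c₁ v₁ L s₂ c₂ v₂ M n m = begin
    sumTo n (λ i → sumTo m (λ j → genSeries s₁ c₁ v₁ L i j * genSeries s₂ c₂ v₂ M (n ∸ i) (m ∸ j)))
  ≡⟨ sumTo-cong n (λ i _ → sumTo-cong m (λ j _ → ∑-*-∑ L M _ _)) ⟩
    sumTo n (λ i → sumTo m (λ j → ∑[ x ∈ L ] ∑[ y ∈ M ] term i j x y))
  ≡⟨ sumTo-cong n (λ i _ → sumTo-∑∑-comm m (term i)) ⟩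
    sumTo n (λ i → ∑[ x ∈ L ] ∑[ y ∈ M ] sumTo m (λ j → term i j x y))
  ≡⟨ sumTo-∑∑-comm n (λ i x y → sumTo m (λ j → term i j x y)) ⟩
    ∑[ x ∈ L ] ∑[ y ∈ M ] sumTo n (λ i → sumTo m (λ j → term i j x y))
  ≡⟨ ∑-cong L (λ x → ∑-cong M (λ y → collapse x y)) ⟩
    ∑[ x ∈ L ] ∑[ y ∈ M ] [ s₁ x ℕ.+ s₂ y ≟ n ]· [ c₁ x ℕ.+ c₂ y ≟ m ]· (v₁ x * v₂ y)
  ∎
  where
  term : ℕ → ℕ → X → Y → ℚ
  term i j x y = ([ s₁ x ≟ i ]· [ c₁ x ≟ j ]· v₁ x) * ([ s₂ y ≟ n ∸ i ]· [ c₂ y ≟ m ∸ j ]· v₂ y)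

  sumTo-∑∑-comm : ∀ k (f : ℕ → X → Y → ℚ) →
    sumTo k (λ i → ∑[ x ∈ L ] ∑[ y ∈ M ] f i x y) ≡ ∑[ x ∈ L ] ∑[ y ∈ M ] sumTo k (λ i → f i x y)
  sumTo-∑∑-comm k f = trans (sumTo-∑-comm k L _) (∑-cong L (λ x → sumTo-∑-comm k M (λ i → f i x)))

  collapse : ∀ x y → sumTo n (λ i → sumTo m (λ j → term i j x y)) ≡
                     [ s₁ x ℕ.+ s₂ y ≟ n ]· [ c₁ x ℕ.+ c₂ y ≟ m ]· (v₁ x * v₂ y)
  collapse x y = begin
      sumTo n (λ i → sumTo m (λ j → term i j x y))
    ≡⟨ sumTo-cong n (λ i _ → sumTo-cong m (λ j _ →
         []·-*-[]· (s₁ x ≟ i) (c₁ x ≟ j) (s₂ y ≟ n ∸ i) (c₂ y ≟ m ∸ j) (v₁ x) (v₂ y))) ⟩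
      sumTo n (λ i → sumTo m (λ j →
        [ s₁ x ≟ i ]· [ s₂ y ≟ n ∸ i ]· [ c₁ x ≟ j ]· [ c₂ y ≟ m ∸ j ]· v))
    ≡⟨ sumTo-cong n (λ i _ → pull-out (s₁ x ≟ i) (s₂ y ≟ n ∸ i)) ⟩
      sumTo n (λ i → [ s₁ x ≟ i ]· [ s₂ y ≟ n ∸ i ]·
        sumTo m (λ j → [ c₁ x ≟ j ]· [ c₂ y ≟ m ∸ j ]· v))
    ≡⟨ sumTo-cong n (λ i _ →
         cong (λ z → [ s₁ x ≟ i ]· [ s₂ y ≟ n ∸ i ]· z) (sumTo-convolution m (c₁ x) (c₂ y) v)) ⟩
      sumTo n (λ i → [ s₁ x ≟ i ]· [ s₂ y ≟ n ∸ i ]· [ c₁ x ℕ.+ c₂ y ≟ m ]· v)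
    ≡⟨ sumTo-convolution n (s₁ x) (s₂ y) ([ c₁ x ℕ.+ c₂ y ≟ m ]· v) ⟩
      [ s₁ x ℕ.+ s₂ y ≟ n ]· [ c₁ x ℕ.+ c₂ y ≟ m ]· v
    ∎
    where
    v = v₁ x * v₂ y
    pull-out : (d : Dec P) (e : Dec Q) →
      sumTo m (λ j → [ d ]· [ e ]· [ c₁ x ≟ j ]· [ c₂ y ≟ m ∸ j ]· v) ≡
      [ d ]· [ e ]· sumTo m (λ j → [ c₁ x ≟ j ]· [ c₂ y ≟ m ∸ j ]· v)
    pull-out d e = sym (trans (cong ([ d ]·_) ([]·-distrib-sumTo e m _)) ([]·-distrib-sumTo d m _))

tuples : ℕ → List X → List (List X)
tuples zero    L = [] ∷ []
tuples (suc k) L = concatMap (λ x → map (x ∷_) (tuples k L)) L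

∑-tuples-length : ∀ k (L : List X) (f : ℕ → List X → ℚ) →
  ∑[ xs ∈ tuples k L ] f (length xs) xs ≡ ∑ (tuples k L) (f k)
∑-tuples-length zero    L f = refl
∑-tuples-length (suc k) L f = begin
    ∑[ xs ∈ tuples (suc k) L ] f (length xs) xs
  ≡⟨ ∑-conses L _ _ ⟩
    ∑[ x ∈ L ] ∑[ xs ∈ tuples k L ] f (suc (length xs)) (x ∷ xs)
  ≡⟨ ∑-cong L (λ x → ∑-tuples-length k L (λ l xs → f (suc l) (x ∷ xs))) ⟩
    ∑[ x ∈ L ] ∑[ xs ∈ tuples k L ] f (suc k) (x ∷ xs)
  ≡⟨ ∑-conses L _ _ ⟨
    ∑ (tuples (suc k) L) (f (suc k))
  ∎

∑-tuples-vanishing : ∀ k (L : List X) {f : List X → ℚ} →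
  (∀ xs → length xs ≡ k → f xs ≡ 0ℚ) → ∑ (tuples k L) f ≡ 0ℚ
∑-tuples-vanishing zero    L f≡0 = cong (_+ 0ℚ) (f≡0 [] refl)
∑-tuples-vanishing (suc k) L f≡0 = trans (∑-conses L _ _)
  (∑-zero L (λ x → ∑-tuples-vanishing k L (λ xs len≡k → f≡0 (x ∷ xs) (cong suc len≡k))))

∑-forestsF : ∀ l N (f : List Tree → ℚ) →
  ∑ (forestsF l N) f ≡ sumTo l (λ k → ∑ (tuples k (treesLe N)) f)
∑-forestsF zero    N f = refl
∑-forestsF (suc l) N f = begin
    f [] + ∑ (concatMap (λ t → map (t ∷_) (forestsF l N)) T) f
  ≡⟨ cong (f [] +_) (∑-conses T _ f) ⟩
    f [] + (∑[ t ∈ T ] ∑[ ts ∈ forestsF l N ] f (t ∷ ts))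
  ≡⟨ cong (f [] +_) (∑-cong T (λ t → ∑-forestsF l N (λ ts → f (t ∷ ts)))) ⟩
    f [] + (∑[ t ∈ T ] sumTo l (λ k → ∑[ ts ∈ tuples k T ] f (t ∷ ts)))
  ≡⟨ cong (f [] +_) (sumTo-∑-comm l T _) ⟨
    f [] + sumTo l (λ k → ∑[ t ∈ T ] ∑[ ts ∈ tuples k T ] f (t ∷ ts))
  ≡⟨ cong₂ _+_ (ℚₚ.+-identityʳ (f [])) (sumTo-cong l (λ k _ → ∑-conses T _ f)) ⟨
    ∑ (tuples 0 T) f + sumTo l (λ k → ∑ (tuples (suc k) T) f)
  ≡⟨ sumTo-suc l _ ⟨
    sumTo (suc l) (λ k → ∑ (tuples k T) f)
  ∎
  where T = treesLe N

VanishesBeyond : (X → ℕ) → ℕ → (X → ℚ) → Set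
VanishesBeyond s p f = ∀ x → p < s x → f x ≡ 0ℚ

0<size : ∀ t → 0 < size t
0<size (node _) = s≤s z≤n

length≤sizes : ∀ ts → length ts ≤ sizes ts
length≤sizes []             = z≤n
length≤sizes (node us ∷ ts) = s≤s (≤-trans (length≤sizes ts) (m≤n+m (sizes ts) (sizes us)))

mutual
  ∑-treesLe-suc : ∀ N {p} {g : Tree → ℚ} → p ≤ N → VanishesBeyond size p g →
    ∑ (treesLe (suc N)) g ≡ ∑ (treesLe N) g
  ∑-treesLe-suc N {zero} _ g≡0 =
    trans (∑-zero (treesLe (suc N)) g≡0′) (sym (∑-zero (treesLe N) g≡0′))
    where g≡0′ = λ t → g≡0 t (0<size t)
  ∑-treesLe-suc zero    {suc _} ()
  ∑-treesLe-suc (suc N) {suc p} {g} (s≤s p≤N) g≡0 = begin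
      ∑ (map node (forestsF (suc N) (suc N))) g
    ≡⟨ ∑-map node (forestsF (suc N) (suc N)) g ⟩
      ∑[ ts ∈ forestsF (suc N) (suc N) ] g (node ts)
    ≡⟨ ∑-forestsF-suc N p≤N (λ ts p<sizes → g≡0 (node ts) (s≤s p<sizes)) ⟩
      ∑[ ts ∈ forestsF N N ] g (node ts)
    ≡⟨ ∑-map node (forestsF N N) g ⟨
      ∑ (map node (forestsF N N)) g
    ∎

  ∑-forestsF-suc : ∀ N {p} {f : List Tree → ℚ} → p ≤ N → VanishesBeyond sizes p f →
    ∑ (forestsF (suc N) (suc N)) f ≡ ∑ (forestsF N N) f
  ∑-forestsF-suc N {p} {f} p≤N f≡0 = begin
      ∑ (forestsF (suc N) (suc N)) f
    ≡⟨ ∑-forestsF (suc N) (suc N) f ⟩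
      sumTo (suc N) (λ k → ∑ (tuples k (treesLe (suc N))) f)
    ≡⟨ sumTo-cong (suc N) (λ k _ → ∑-tuples-treesLe-suc k N p≤N f≡0) ⟩
      shorter + ∑ (tuples (suc N) (treesLe N)) f
    ≡⟨ cong (shorter +_) (∑-tuples-vanishing (suc N) (treesLe N) (λ ts → f≡0 ts ∘ too-long ts)) ⟩
      shorter + 0ℚ
    ≡⟨ ℚₚ.+-identityʳ shorter ⟩
      shorter
    ≡⟨ ∑-forestsF N N f ⟨
      ∑ (forestsF N N) f
    ∎
    where
    shorter = sumTo N (λ k → ∑ (tuples k (treesLe N)) f)
    too-long : ∀ ts → length ts ≡ suc N → p < sizes ts
    too-long ts len≡ = <-≤-trans (s≤s p≤N) (subst (_≤ sizes ts) len≡ (length≤sizes ts))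

  ∑-tuples-treesLe-suc : ∀ k N {p} {f : List Tree → ℚ} → p ≤ N → VanishesBeyond sizes p f →
    ∑ (tuples k (treesLe (suc N))) f ≡ ∑ (tuples k (treesLe N)) f
  ∑-tuples-treesLe-suc zero    N _ _ = refl
  ∑-tuples-treesLe-suc (suc k) N {p} {f} p≤N f≡0 = begin
      ∑ (tuples (suc k) (treesLe (suc N))) f
    ≡⟨ ∑-conses (treesLe (suc N)) _ f ⟩
      ∑[ t ∈ treesLe (suc N) ] ∑[ ts ∈ tuples k (treesLe (suc N)) ] f (t ∷ ts)
    ≡⟨ ∑-cong (treesLe (suc N))
         (λ t → ∑-tuples-treesLe-suc k N (≤-trans (m∸n≤m p (size t)) p≤N) (tails-vanish t)) ⟩
      ∑[ t ∈ treesLe (suc N) ] ∑[ ts ∈ tuples k (treesLe N) ] f (t ∷ ts)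
    ≡⟨ ∑-treesLe-suc N p≤N heads-vanish ⟩
      ∑[ t ∈ treesLe N ] ∑[ ts ∈ tuples k (treesLe N) ] f (t ∷ ts)
    ≡⟨ ∑-conses (treesLe N) _ f ⟨
      ∑ (tuples (suc k) (treesLe N)) f
    ∎
    where
    tails-vanish : ∀ t → VanishesBeyond sizes (p ∸ size t) (λ ts → f (t ∷ ts))
    tails-vanish t ts p∸size<sizes =
      f≡0 (t ∷ ts) (≤-<-trans (m≤n+m∸n p (size t)) (+-monoʳ-< (size t) p∸size<sizes))

    heads-vanish : VanishesBeyond size p (λ t → ∑[ ts ∈ tuples k (treesLe N) ] f (t ∷ ts))
    heads-vanish t p<size =
      ∑-zero (tuples k (treesLe N))
        (λ ts → f≡0 (t ∷ ts) (<-≤-trans p<size (m≤m+n (size t) (sizes ts))))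

∑-treesLe-stable : ∀ {p N} {g : Tree → ℚ} → p ≤ N → VanishesBeyond size p g →
  ∑ (treesLe N) g ≡ ∑ (treesLe p) g
∑-treesLe-stable {p} {g = g} p≤N g≡0 = go (≤⇒≤′ p≤N)
  where
  go : ∀ {N} → p ≤′ N → ∑ (treesLe N) g ≡ ∑ (treesLe p) g
  go ≤′-refl             = refl
  go (≤′-step {N} p≤′N) = trans (∑-treesLe-suc N (≤′⇒≤ p≤′N) g≡0) (go p≤′N)

heights≤height : ∀ ts → heights ts ≤ height (node ts)
heights≤height []       = z≤n
heights≤height (t ∷ ts) = n≤1+n _

mutual
  cutLeaves-low : ∀ r t → height t < r → cutLeaves r t ≡ size t
  cutLeaves-low r (node ts) h<r with height (node ts) <? r
  ... | yes _  = cong suc (cutLeavesL-low r ts (≤-<-trans (heights≤height ts) h<r))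
  ... | no h≮r = contradiction h<r h≮r

  cutLeavesL-low : ∀ r ts → heights ts < r → cutLeavesL r ts ≡ sizes ts
  cutLeavesL-low r []       _   = refl
  cutLeavesL-low r (t ∷ ts) h<r =
    cong₂ ℕ._+_ (cutLeaves-low r t (m⊔n<o⇒m<o _ _ h<r)) (cutLeavesL-low r ts (m⊔n<o⇒n<o _ _ h<r))

x≡y+[x-y] : ∀ x y → x ≡ y + (x - y)
x≡y+[x-y] = solve 2 (λ x y → x := y :+ (x :- y)) refl
  where open +-*-Solver

-- If height (node ts) < r, all n + 1 vertices are counted; otherwise the root is not.
root-split : ∀ r n m ts x →
  [ sizes ts ≟ n ]· [ cutLeaves r (node ts) ≟ m ]· x ≡
  [ sizes ts ≟ n ]· [ cutLeavesL r ts ≟ m ]· x +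
    ([ suc n ≟ m ]· [ sizes ts ≟ n ]· [ height (node ts) <? r ]· x -
     [ suc n ≟ suc m ]· [ sizes ts ≟ n ]· [ height (node ts) <? r ]· x)
root-split r n m ts x with sizes ts ≟ n | height (node ts) <? r
... | no _      | _       =
  sym (cong₂ (λ a b → 0ℚ + (a - b)) ([]·-zero (suc n ≟ m)) ([]·-zero (suc n ≟ suc m)))
... | yes _     | no _    = sym (trans
  (cong₂ (λ a b → [ cutLeavesL r ts ≟ m ]· x + (a - b))
         ([]·-zero (suc n ≟ m)) ([]·-zero (suc n ≟ suc m)))
  (ℚₚ.+-identityʳ _))
... | yes s≡n | yes h<r
  rewrite trans (cutLeavesL-low r ts (≤-<-trans (heights≤height ts) h<r)) s≡n = trans
  (x≡y+[x-y] _ ([ n ≟ m ]· x))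
  (cong (λ b → [ n ≟ m ]· x + ([ suc n ≟ m ]· x - b)) (sym ([]·-suc≟suc n m x)))

∑-filter-treesOfSize : ∀ n {P : Tree → Set} (P? : Decidable P) (f : Tree → ℚ) →
  ∑ (filter P? (treesOfSize n)) f ≡ ∑[ t ∈ treesLe n ] [ size t ≟ n ]· [ P? t ]· f t
∑-filter-treesOfSize n P? f =
  trans (∑-filter P? (treesOfSize n) f) (∑-filter (λ t → size t ≟ n) (treesLe n) _)

∑-filter-treesOfSize-suc : ∀ n {P : Tree → Set} (P? : Decidable P) (f : Tree → ℚ) →
  ∑ (filter P? (treesOfSize (suc n))) f ≡
  ∑[ ts ∈ forestsF n n ] [ sizes ts ≟ n ]· [ P? (node ts) ]· f (node ts)
∑-filter-treesOfSize-suc n P? f = begin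
    ∑ (filter P? (treesOfSize (suc n))) f
  ≡⟨ ∑-filter-treesOfSize (suc n) P? f ⟩
    ∑[ t ∈ map node (forestsF n n) ] [ size t ≟ suc n ]· [ P? t ]· f t
  ≡⟨ ∑-map node (forestsF n n) _ ⟩
    ∑[ ts ∈ forestsF n n ] [ suc (sizes ts) ≟ suc n ]· [ P? (node ts) ]· f (node ts)
  ≡⟨ ∑-cong (forestsF n n) (λ ts → []·-suc≟suc (sizes ts) n _) ⟩
    ∑[ ts ∈ forestsF n n ] [ sizes ts ≟ n ]· [ P? (node ts) ]· f (node ts)
  ∎

module _ (w : ℕ → ℚ) (r : ℕ) where

  A≡genSeries-treesLe : ∀ {N n} m → n ≤ N →
    A w r n m ≡ genSeries size (cutLeaves r) (weight w) (treesLe N) n m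
  A≡genSeries-treesLe {N} {n} m n≤N = trans
    (∑-filter-treesOfSize n (λ t → cutLeaves r t ≟ m) (weight w))
    (sym (∑-treesLe-stable n≤N
      (λ t n<size → []·-no (size t ≟ n) (λ s≡n → <-irrefl (sym s≡n) n<size) _)))

  A^k≡genSeries-tuples : ∀ k {N n} m → n ≤ N →
    (A w r ^S k) n m ≡ genSeries sizes (cutLeavesL r) (weightL w) (tuples k (treesLe N)) n m
  A^k≡genSeries-tuples zero    {n = zero}  zero    _ = refl
  A^k≡genSeries-tuples zero    {n = zero}  (suc m) _ = refl
  A^k≡genSeries-tuples zero    {n = suc n} zero    _ = refl
  A^k≡genSeries-tuples zero    {n = suc n} (suc m) _ = refl
  A^k≡genSeries-tuples (suc k) {N} {n} m n≤N = begin
      (A w r ⊛ (A w r ^S k)) n m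
    ≡⟨ ⊛-cong n m (λ i j i≤n → A≡genSeries-treesLe j (≤-trans i≤n n≤N))
                  (λ i j i≤n → A^k≡genSeries-tuples k j (≤-trans i≤n n≤N)) ⟩
      (genSeries size (cutLeaves r) (weight w) T ⊛
       genSeries sizes (cutLeavesL r) (weightL w) (tuples k T)) n m
    ≡⟨ genSeries-⊛ size (cutLeaves r) (weight w) T
                   sizes (cutLeavesL r) (weightL w) (tuples k T) n m ⟩
      ∑[ t ∈ T ] ∑[ ts ∈ tuples k T ]
        [ size t ℕ.+ sizes ts ≟ n ]· [ cutLeaves r t ℕ.+ cutLeavesL r ts ≟ m ]·
          (weight w t * weightL w ts)
    ≡⟨ ∑-conses T (tuples k T) _ ⟨
      genSeries sizes (cutLeavesL r) (weightL w) (tuples (suc k) T) n m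
    ∎
    where T = treesLe N

  ∑-forestsF-Φ : ∀ n m →
    ∑[ ts ∈ forestsF n n ] [ sizes ts ≟ n ]· [ cutLeavesL r ts ≟ m ]· weight w (node ts) ≡
    applyΦ w (A w r) n m
  ∑-forestsF-Φ n m = trans (∑-forestsF n n _) (sumTo-cong n (λ k _ → k-subtrees k))
    where
    T = treesLe n

    rooted : ℕ → List Tree → ℚ
    rooted l ts = [ sizes ts ≟ n ]· [ cutLeavesL r ts ≟ m ]· (w l * weightL w ts)

    k-subtrees : ∀ k → ∑[ ts ∈ tuples k T ] rooted (length ts) ts ≡ w k * (A w r ^S k) n m
    k-subtrees k = begin
        ∑[ ts ∈ tuples k T ] rooted (length ts) ts
      ≡⟨ ∑-tuples-length k T rooted ⟩
        ∑ (tuples k T) (rooted k)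
      ≡⟨ ∑-cong (tuples k T) (λ ts →
           pull-out (sizes ts ≟ n) (cutLeavesL r ts ≟ m) (weightL w ts)) ⟩
        ∑[ ts ∈ tuples k T ] w k * ([ sizes ts ≟ n ]· [ cutLeavesL r ts ≟ m ]· weightL w ts)
      ≡⟨ *-distribˡ-∑ (w k) (tuples k T) _ ⟨
        w k * genSeries sizes (cutLeavesL r) (weightL w) (tuples k T) n m
      ≡⟨ cong (w k *_) (A^k≡genSeries-tuples k m ≤-refl) ⟨
        w k * (A w r ^S k) n m
      ∎
      where
      pull-out : (d : Dec P) (e : Dec Q) → ∀ y → [ d ]· [ e ]· (w k * y) ≡ w k * ([ d ]· [ e ]· y)
      pull-out d e y = sym (trans ([]·-*ʳ d (w k) _) (cong ([ d ]·_) ([]·-*ʳ e (w k) y)))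

  A-remove-root : ∀ n m →
    A w r (suc n) m ≡
    (∑[ ts ∈ forestsF n n ] [ sizes ts ≟ n ]· [ cutLeavesL r ts ≟ m ]· weight w (node ts)) +
    oneMinusInvU (FatXU w r) (suc n) m
  A-remove-root n m = begin
      A w r (suc n) m
    ≡⟨ ∑-filter-treesOfSize-suc n (λ t → cutLeaves r t ≟ m) (weight w) ⟩
      ∑[ ts ∈ Fs ] [ sizes ts ≟ n ]· [ cutLeaves r (node ts) ≟ m ]· weight w (node ts)
    ≡⟨ ∑-cong Fs (λ ts → root-split r n m ts (weight w (node ts))) ⟩
      ∑[ ts ∈ Fs ] (forest ts + Δ (low ts))
    ≡⟨ ∑-distrib-+ Fs forest (Δ ∘ low) ⟩
      ∑ Fs forest + ∑ Fs (Δ ∘ low)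
    ≡⟨ cong (∑ Fs forest +_) ∑-Δ ⟩
      ∑ Fs forest + Δ (∑ Fs low)
    ≡⟨ cong (λ f → ∑ Fs forest + Δ f)
            (∑-filter-treesOfSize-suc n (λ t → height t <? r) (weight w)) ⟨
      ∑ Fs forest + Δ (F w r (suc n))
    ∎
    where
    Fs = forestsF n n

    forest low : List Tree → ℚ
    forest ts = [ sizes ts ≟ n ]· [ cutLeavesL r ts ≟ m ]· weight w (node ts)
    low    ts = [ sizes ts ≟ n ]· [ height (node ts) <? r ]· weight w (node ts)

    Δ : ℚ → ℚ
    Δ f = [ suc n ≟ m ]· f - [ suc n ≟ suc m ]· f

    ∑-Δ : ∑ Fs (Δ ∘ low) ≡ Δ (∑ Fs low)
    ∑-Δ = trans (∑-distrib-- Fs _ _)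
      (sym (cong₂ _-_ ([]·-distrib-∑ (suc n ≟ m) Fs low) ([]·-distrib-∑ (suc n ≟ suc m) Fs low)))

proposition3p1 : (w : ℕ → ℚ) → (∀ k → 0ℚ ≤ℚ w k) → w 0 ≡ 1ℚ →
    (r : ℕ) → 1 ≤ r →
    ∀ n m → A w r n m ≡
      (xTimes (applyΦ w (A w r)) ⊕ oneMinusInvU (FatXU w r)) n m
proposition3p1 w _ _ r _ zero    zero    = refl
proposition3p1 w _ _ r _ zero    (suc m) = refl
proposition3p1 w _ _ r _ (suc n) m       = begin
    A w r (suc n) m
  ≡⟨ A-remove-root w r n m ⟩
    (∑[ ts ∈ forestsF n n ] [ sizes ts ≟ n ]· [ cutLeavesL r ts ≟ m ]· weight w (node ts))
      + correction
  ≡⟨ cong (_+ correction) (∑-forestsF-Φ w r n m) ⟩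
    applyΦ w (A w r) n m + correction
  ∎
  where correction = oneMinusInvU (FatXU w r) (suc n) m
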